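{- Let $r\in\{1,2\}$, let $2\le n_1\le\cdots\le n_l$ be integers, and set $n=\sum_{i=1}^l n_i$. Suppose that a graph $G$ contains an $(n',k)$-weak ladder with $n'\ge n-r$, $k\ge r$ and $n\ge 6k+12$, and also a ladder $L_{n''}$ vertex-disjoint from it with $n''\ge n/3$. If $G$ does not contain vertex-disjoint cycles $C_{2n_1},\dots,C_{2n_l}$, then $l=2$ and $$\left\lfloor\frac{n+1-r}{2}\right\rfloor\le n_1\le\frac n2\le n_2\le\left\lceil\frac{n+r-1}{2}\right\rceil.$$
   Context: An $n$-ladder $L_n$ is the balanced bipartite graph with parts $A=\{a_1,\dots,a_n\}$, $B=\{b_1,\dots,b_n\}$ in which $a_ib_j$ is an edge iff $|i-j|\le1$; the edges $a_ib_i$ are its rungs, $a_1b_1$ the first rung. Let $L_{n_1},L_{n_2}$ be two vertex-disjoint ladders in $G$ with $n_1\le n_2$ and first rungs $\{a_1,b_1\}$ and $\{a_1',b_1'\}$ respectively. If there exist an $a_1$–$a_1'$ path $P_1$ and a $b_1$–$b_1'$ path $P_2$ whose sets of interior vertices $\mathring P_1,\mathring P_2$ are disjoint from each other and from $L_{n_1}\cup L_{n_2}$, with $|\mathring P_1|+|\mathring P_2|=2k$, then $L_{n_1}\cup L_{n_2}\cup P_1\cup P_2$ is called an $(n_1+n_2,k)$-weak ladder. $C_m$ is the cycle on $m$ vertices. -}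

module Defs where

open import Data.Nat using (ℕ; zero; suc; _+_; _*_; _≤_)
open import Data.Fin using (Fin; toℕ) renaming (zero to fzero)
open import Data.List using (List; []; _∷_; _++_; [_]; length; concat; tabulate)
open import Data.List.Relation.Unary.Linked using (Linked)
open import Data.List.Relation.Unary.Unique.Propositional using (Unique)
open import Data.List.Relation.Binary.Pointwise using (Pointwise)
open import Data.Product using (Σ; _×_; ∃; ∃-syntax)
open import Relation.Binary.PropositionalEquality using (_≡_)
open import Relation.Nullary using (¬_)

record Graph (N : ℕ) : Set₁ where
  field
    Adj   : Fin N → Fin N → Set
    sym   : ∀ {x y} → Adj x y → Adj y x
    irrefl : ∀ {x} → ¬ Adj x x

module _ {N : ℕ} (G : Graph N) where
  open Graph G

  -- An m-ladder in G (as a subgraph, not necessarily induced):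
  -- a i = a_{i+1}, b j = b_{j+1}; a_i b_j is an edge whenever |i-j| ≤ 1.
  -- Injectivity of the embedding is imposed via Unique on the vertex list
  -- wherever the ladder is used.
  record Ladder (m : ℕ) : Set where
    field
      a : Fin m → Fin N
      b : Fin m → Fin N
      edges : ∀ (i j : Fin m) → toℕ i ≤ suc (toℕ j) → toℕ j ≤ suc (toℕ i) → Adj (a i) (b j)

  ladderVerts : ∀ {m} → Ladder m → List (Fin N)
  ladderVerts L = tabulate (Ladder.a L) ++ tabulate (Ladder.b L)

  IsPath : Fin N → List (Fin N) → Fin N → Set
  IsPath x p y = Linked Adj (x ∷ p ++ [ y ])

  -- An (n' , k)-weak ladder: ladders L_{n1}, L_{n2} (n1 = suc m1 ≤ n2 = suc m2),
  -- paths a1–a1' and b1–b1' with interiors P1, P2, |P1|+|P2| = 2k,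
  -- all listed vertices pairwise distinct.
  record WeakLadder (n' k : ℕ) : Set where
    field
      m1 m2 : ℕ
      n1≤n2 : suc m1 ≤ suc m2
      total : suc m1 + suc m2 ≡ n'
      L1 : Ladder (suc m1)
      L2 : Ladder (suc m2)
      P1 P2 : List (Fin N)
      path1 : IsPath (Ladder.a L1 fzero) P1 (Ladder.a L2 fzero)
      path2 : IsPath (Ladder.b L1 fzero) P2 (Ladder.b L2 fzero)
      interiorSize : length P1 + length P2 ≡ 2 * k
      distinct : Unique (ladderVerts L1 ++ ladderVerts L2 ++ P1 ++ P2)

  weakLadderVerts : ∀ {n' k} → WeakLadder n' k → List (Fin N)
  weakLadderVerts W = ladderVerts L1 ++ ladderVerts L2 ++ P1 ++ P2
    where open WeakLadder W

  -- c lists the vertices of a cycle of length m (m ≥ 3) in cyclic order;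
  -- distinctness of the vertices is imposed by the caller via Unique.
  IsCycle : ℕ → List (Fin N) → Set
  IsCycle m c = length c ≡ m × 3 ≤ m ×
    (∃[ x ] ∃[ xs ] (c ≡ x ∷ xs × Linked Adj (x ∷ xs ++ [ x ])))

  HasDisjointEvenCycles : List ℕ → Set
  HasDisjointEvenCycles ns =
    ∃[ cs ] (Pointwise (λ m c → IsCycle (2 * m) c) ns cs × Unique (concat cs))

-- A cycle C_{2x} with x ≥ 2 is traced by x consecutive rungs of a ladder, zigzagging between the
-- rails, and for j₁, j₂ ≥ 1 the first j₁ rungs of L_{n₁}, the first j₂ rungs of L_{n₂} and the two
-- connecting paths form a cycle of length 2(j₁ + j₂ + k). So it suffices to cut n₁ ≤ ⋯ ≤ n_l into
-- consecutive groups filling the spare ladder L_{n''} and the two ladders of the weak ladder, the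
-- largest n_l possibly becoming such a long cycle. Filling greedily, n ≤ n' + r and n ≤ 3n'' leave
-- so little slack that this succeeds unless l = 2 and n₂ ≤ n₁ + r, where the bounds are immediate.
module Submission where

open import Defs
open import Data.Nat
open import Data.Nat.Properties
open import Data.Nat.ListAction using (sum)
open import Data.Nat.ListAction.Properties using (sum-++)
open import Data.Nat.Tactic.RingSolver using (solve-∀)
open import Data.Fin using (Fin; toℕ; fromℕ<) renaming (zero to fzero; suc to fsuc)
open import Data.Fin.Properties using (toℕ-fromℕ<)
open import Data.List using (List; []; _∷_; _++_; [_]; _∷ʳ_; length; map; concat; tabulate; reverse; applyUpTo; applyDownFrom)
open import Data.List.Properties
  using (++-assoc; ++-conicalʳ; ++-identityʳ; ++-monoid; unfold-reverse; length-++; length-map; length-tabulate;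
         length-reverse; length-applyUpTo; map-++; map-id; map-applyUpTo; reverse-applyUpTo; concat-map; concat-++)
open import Data.List.Reverse using (reverseView; []; _∶_∶ʳ_)
open import Data.List.Relation.Unary.All using (All; []; _∷_)
import Data.List.Relation.Unary.All as All
import Data.List.Relation.Unary.All.Properties as Allₚ
open import Data.List.Relation.Unary.AllPairs using (AllPairs; []; _∷_)
open import Data.List.Relation.Unary.Any using (here; there)
open import Data.List.Relation.Unary.Linked using (Linked; [-]; _∷_)
import Data.List.Relation.Unary.Linked.Properties as Linkedₚ
open import Data.List.Relation.Unary.Unique.Propositional using (Unique)
import Data.List.Relation.Unary.Unique.Propositional.Properties as Uniqueₚ
open import Data.List.Relation.Binary.Disjoint.Propositional using (Disjoint)
open import Data.List.Relation.Binary.Pointwise using (Pointwise; []; _∷_)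
import Data.List.Relation.Binary.Pointwise as Pointwise
open import Data.List.Membership.Propositional using (_∈_)
open import Data.List.Membership.Propositional.Properties using (∈-map⁺; ∈-concat⁺′)
open import Data.Product using (_×_; _,_; proj₁; proj₂; ∃₂; ∃-syntax)
open import Data.Sum using (_⊎_; inj₁; inj₂; [_,_]′)
open import Data.Unit using (⊤; tt)
open import Data.Empty using (⊥-elim)
open import Function using (id)
open import Level using (0ℓ)
open import Relation.Binary.PropositionalEquality hiding ([_])
open import Relation.Nullary using (¬_; Dec; yes; no)
open import Relation.Unary using (Pred; _∪_; _⊥_; _⊆_)
open import Tactic.MonoidSolver using (solve)

module _ {A : Set} where

  nth : A → List A → ℕ → A
  nth d []       _       = d
  nth d (x ∷ xs) zero    = x
  nth d (x ∷ xs) (suc i) = nth d xs i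

  nth-∈ : ∀ d xs {i} → i < length xs → nth d xs i ∈ xs
  nth-∈ d (x ∷ xs) {zero}  _        = here refl
  nth-∈ d (x ∷ xs) {suc i} (s≤s i<) = there (nth-∈ d xs i<)

  nth-injective : ∀ d {xs i j} → Unique xs → i < length xs → j < length xs → nth d xs i ≡ nth d xs j → i ≡ j
  nth-injective d {x ∷ xs} {zero}  {zero}  _          _        _        _ = refl
  nth-injective d {x ∷ xs} {zero}  {suc j} (x∉ ∷ _)  _        (s≤s j<) e = ⊥-elim (All.lookup x∉ (nth-∈ d xs j<) e)
  nth-injective d {x ∷ xs} {suc i} {zero}  (x∉ ∷ _)  (s≤s i<) _        e = ⊥-elim (All.lookup x∉ (nth-∈ d xs i<) (sym e))
  nth-injective d {x ∷ xs} {suc i} {suc j} (_ ∷ uxs) (s≤s i<) (s≤s j<) e = cong suc (nth-injective d uxs i< j< e)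

  applyUpTo-nth : ∀ d xs → applyUpTo (nth d xs) (length xs) ≡ xs
  applyUpTo-nth d []       = refl
  applyUpTo-nth d (x ∷ xs) = cong (x ∷_) (applyUpTo-nth d xs)

  unique-++⁻ : ∀ xs {ys} → Unique (xs ++ ys) → Unique xs × Unique ys × Disjoint {A = A} xs ys
  unique-++⁻ []       u          = [] , u , λ ()
  unique-++⁻ (x ∷ xs) {ys} (x∉ ∷ u) with unique-++⁻ xs {ys} u
  ... | uxs , uys , xs#ys = Allₚ.++⁻ˡ xs x∉ ∷ uxs , uys , disjoint
    where
    disjoint : Disjoint {A = A} (x ∷ xs) ys
    disjoint (here refl , v∈ys) = All.lookup (Allₚ.++⁻ʳ xs x∉) v∈ys refl
    disjoint (there v∈xs , v∈ys) = xs#ys (v∈xs , v∈ys)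

nth-tabulate : ∀ {A : Set} (d : A) {m} (f : Fin m → A) {i} (i<m : i < m) → nth d (tabulate f) i ≡ f (fromℕ< i<m)
nth-tabulate d {suc m} f {zero}  _        = refl
nth-tabulate d {suc m} f {suc i} (s≤s i<) = nth-tabulate d (λ j → f (fsuc j)) i<

concat-coordinate-injective : ∀ {K A : Set} (d : A) (f : K → List A) {ks} → Unique (concat (map f ks)) →
  ∀ {k k′ i i′} → k ∈ ks → k′ ∈ ks → i < length (f k) → i′ < length (f k′) →
  nth d (f k) i ≡ nth d (f k′) i′ → (k , i) ≡ (k′ , i′)
concat-coordinate-injective d f {k₀ ∷ ks} u (here refl) (here refl) i< i′< e =
  cong (k₀ ,_) (nth-injective d (proj₁ (unique-++⁻ (f k₀) u)) i< i′< e)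
concat-coordinate-injective d f {k₀ ∷ ks} u (here refl) (there k′∈) i< i′< e =
  ⊥-elim (proj₂ (proj₂ (unique-++⁻ (f k₀) u))
    (nth-∈ d (f k₀) i< , subst (_∈ concat (map f ks)) (sym e) (∈-concat⁺′ (nth-∈ d _ i′<) (∈-map⁺ f k′∈))))
concat-coordinate-injective d f {k₀ ∷ ks} u (there k∈) (here refl) i< i′< e =
  ⊥-elim (proj₂ (proj₂ (unique-++⁻ (f k₀) u))
    (nth-∈ d (f k₀) i′< , subst (_∈ concat (map f ks)) e (∈-concat⁺′ (nth-∈ d _ i<) (∈-map⁺ f k∈))))
concat-coordinate-injective d f {k₀ ∷ ks} u (there k∈) (there k′∈) i< i′< e =
  concat-coordinate-injective d f (proj₁ (proj₂ (unique-++⁻ (f k₀) u))) k∈ k′∈ i< i′< e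

Path : {A : Set} → (A → A → Set) → A → List A → A → Set
Path R x W y = Linked R (x ∷ W ++ [ y ])

module _ {A : Set} {R : A → A → Set} where

  path-++ : ∀ {x y z} W {W′} → Path R x W y → Path R y W′ z → Path R x (W ++ y ∷ W′) z
  path-++ []      (r ∷ _)  l = r ∷ l
  path-++ (w ∷ W) (r ∷ l₁) l = r ∷ path-++ W l₁ l

  path-reverse : (∀ {a b} → R a b → R b a) → ∀ {x y} W → Path R x W y → Path R y (reverse W) x
  path-reverse sym-R []      (r ∷ [-]) = sym-R r ∷ [-]
  path-reverse sym-R (w ∷ W) (r ∷ l)   =
    subst (λ V → Path R _ V _) (sym (unfold-reverse w W)) (path-++ (reverse W) (path-reverse sym-R W l) (sym-R r ∷ [-]))

unique-map-on : ∀ {A B : Set} {P : Pred A 0ℓ} (f : A → B) → (∀ {x y} → P x → P y → f x ≡ f y → x ≡ y) →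
  ∀ {xs} → All P xs → Unique xs → Unique (map f xs)
unique-map-on f inj []         []         = []
unique-map-on f inj (px ∷ pxs) (x∉ ∷ uxs) =
  Allₚ.map⁺ (All.zipWith (λ (x≢y , py) e → x≢y (inj px py e)) (x∉ , pxs)) ∷ unique-map-on f inj pxs uxs

unique-enclose : ∀ {A : Set} {a b : A} {Z} → a ≢ b → All (a ≢_) Z → All (_≢ b) Z → Unique Z → Unique (a ∷ Z ++ [ b ])
unique-enclose a≢b a∉Z Z≢b uZ =
  Allₚ.++⁺ a∉Z (a≢b ∷ []) ∷ Uniqueₚ.++⁺ uZ ([] ∷ []) λ { (v∈Z , here v≡b) → All.lookup Z≢b v∈Z v≡b }

UniqueIn : {A : Set} → Pred A 0ℓ → List A → Set
UniqueIn Z xs = Unique xs × All Z xs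

module _ {A : Set} {P Q : Pred A 0ℓ} where

  uniqueIn-++ : ∀ {xs ys} → UniqueIn P xs → UniqueIn Q ys → P ⊥ Q → UniqueIn (P ∪ Q) (xs ++ ys)
  uniqueIn-++ (uxs , Pxs) (uys , Qys) P⊥Q =
    Uniqueₚ.++⁺ uxs uys (λ (v∈xs , v∈ys) → P⊥Q (All.lookup Pxs v∈xs , All.lookup Qys v∈ys)) ,
    Allₚ.++⁺ (All.map inj₁ Pxs) (All.map inj₂ Qys)

  uniqueIn-⊆ : ∀ {xs} → P ⊆ Q → UniqueIn P xs → UniqueIn Q xs
  uniqueIn-⊆ P⊆Q (uxs , Pxs) = uxs , All.map P⊆Q Pxs

++-∷ʳ-assoc : ∀ {A : Set} (xs ys zs : List A) c → (xs ++ ys ++ zs) ∷ʳ c ≡ xs ++ ys ++ zs ∷ʳ c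
++-∷ʳ-assoc xs ys zs c = trans (++-assoc xs (ys ++ zs) [ c ]) (cong (xs ++_) (++-assoc ys zs [ c ]))

AllPairs-++⁻ʳ : ∀ {A : Set} {R : A → A → Set} xs {ys} → AllPairs R (xs ++ ys) → AllPairs R ys
AllPairs-++⁻ʳ []       rs       = rs
AllPairs-++⁻ʳ (x ∷ xs) (_ ∷ rs) = AllPairs-++⁻ʳ xs rs

AllPairs-∷ʳ⁻ : ∀ {A : Set} {R : A → A → Set} xs {c} → AllPairs R (xs ∷ʳ c) → All (λ x → R x c) xs
AllPairs-∷ʳ⁻ []       _         = []
AllPairs-∷ʳ⁻ (x ∷ xs) (Rx ∷ rs) = proj₂ (Allₚ.∷ʳ⁻ Rx) ∷ AllPairs-∷ʳ⁻ xs rs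

-- Distributing the cycle lengths

NearPair : ℕ → List ℕ → Set
NearPair r ns = ∃₂ λ x c → ns ≡ x ∷ c ∷ [] × c ≤ x + r

nearPair? : ∀ r ns → Dec (NearPair r ns)
nearPair? r (x ∷ c ∷ []) with c ≤? x + r
... | yes c≤x+r = yes (x , c , refl , c≤x+r)
... | no  c≰x+r = no λ { (_ , _ , refl , c≤x+r) → c≰x+r c≤x+r }
nearPair? r []                = no λ { (_ , _ , () , _) }
nearPair? r (_ ∷ [])          = no λ { (_ , _ , () , _) }
nearPair? r (_ ∷ _ ∷ _ ∷ _)   = no λ { (_ , _ , () , _) }

-- The groups Y₁, Y₂, Y₃ go into the spare ladder (M rungs), L_{n₁} (p rungs) and L_{n₂} (q rungs);
-- a last length j₁ + j₂ + k is the long cycle through the first j₁ and j₂ rungs and both paths.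
data Layout (p q k M : ℕ) (ns : List ℕ) : Set where
  inLadders     : ∀ Y₁ Y₂ Y₃ → ns ≡ Y₁ ++ Y₂ ++ Y₃ →
                  sum Y₁ ≤ M → sum Y₂ ≤ p → sum Y₃ ≤ q → Layout p q k M ns
  withLongCycle : ∀ Y₁ Y₂ Y₃ j₁ j₂ → ns ≡ Y₁ ++ Y₂ ++ Y₃ ++ [ j₁ + j₂ + k ] →
                  sum Y₁ ≤ M → j₁ + sum Y₂ ≤ p → j₂ + sum Y₃ ≤ q → 1 ≤ j₁ → 1 ≤ j₂ → Layout p q k M ns

sum-++₃ : ∀ xs ys zs → sum (xs ++ ys ++ zs) ≡ sum xs + sum ys + sum zs
sum-++₃ xs ys zs = trans (trans (sum-++ xs _) (cong (sum xs +_) (sum-++ ys zs))) (sym (+-assoc (sum xs) _ _))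

sum-∷ʳ : ∀ xs x → sum (xs ∷ʳ x) ≡ sum xs + x
sum-∷ʳ xs x = trans (sum-++ xs [ x ]) (cong (sum xs +_) (+-identityʳ x))

sum-++₃-∷ʳ : ∀ xs ys zs c → sum (xs ++ ys ++ zs ∷ʳ c) ≡ sum xs + sum ys + sum zs + c
sum-++₃-∷ʳ xs ys zs c = trans (sum-++₃ xs ys (zs ∷ʳ c)) (trans (cong (sum xs + sum ys +_) (sum-∷ʳ zs c))
  (sym (+-assoc (sum xs + sum ys) (sum zs) c)))

sum-++-∷ʳ : ∀ xs ys c → sum ((xs ++ ys) ∷ʳ c) ≡ sum xs + sum ys + c
sum-++-∷ʳ xs ys c = trans (sum-∷ʳ (xs ++ ys) c) (cong (_+ c) (sum-++ xs ys))

Saturated : ℕ → List ℕ → List ℕ → Set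
Saturated C ys []      = ⊤
Saturated C ys (z ∷ _) = C < sum ys + z

record Prefix (C : ℕ) (xs : List ℕ) : Set where
  constructor prefix
  field
    taken rest : List ℕ
    split      : xs ≡ taken ++ rest
    fits       : sum taken ≤ C
    saturated  : Saturated C taken rest

saturated-∷ : ∀ {C x} ys zs → x ≤ C → Saturated (C ∸ x) ys zs → Saturated C (x ∷ ys) zs
saturated-∷ ys []      x≤C _ = tt
saturated-∷ {C} {x} ys (z ∷ _) x≤C C∸x<ys+z = begin-strict
  C                ≡⟨ m+[n∸m]≡n x≤C ⟨
  x + (C ∸ x)      <⟨ +-monoʳ-< x C∸x<ys+z ⟩
  x + (sum ys + z) ≡⟨ +-assoc x (sum ys) z ⟨
  x + sum ys + z   ∎
  where open ≤-Reasoning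

greedyPrefix : ∀ C xs → Prefix C xs
greedyPrefix C [] = prefix [] [] refl z≤n tt
greedyPrefix C (x ∷ xs) with x ≤? C
... | no x≰C = prefix [] (x ∷ xs) refl z≤n (≰⇒> x≰C)
... | yes x≤C with greedyPrefix (C ∸ x) xs
...   | prefix ys zs refl fits sat =
  prefix (x ∷ ys) zs refl (≤-trans (+-monoʳ-≤ x fits) (≤-reflexive (m+[n∸m]≡n x≤C))) (saturated-∷ ys zs x≤C sat)

saturated-small : ∀ {C b ys zs} → All (_≤ suc b) zs → Saturated C ys zs → zs ≡ [] ⊎ C ≤ sum ys + b
saturated-small {zs = []}    _           _      = inj₁ refl
saturated-small {ys = ys} {zs = z ∷ _} (z≤ ∷ _) C<ys+z =
  inj₂ (≤-pred (≤-trans C<ys+z (≤-trans (+-monoʳ-≤ (sum ys) z≤) (≤-reflexive (+-suc (sum ys) _)))))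

suc-+-swap-≤ : ∀ {j a} s → j ≤ a → suc j + s ≤ suc s + a
suc-+-swap-≤ {j} s j≤a = s≤s (≤-trans (≤-reflexive (+-comm j s)) (+-monoʳ-≤ s j≤a))

split-long-cycle : ∀ {p q k s₂ s₃ c} → s₂ < p → s₃ < q → 2 + k ≤ c → s₂ + s₃ + c ≤ p + q + k →
  ∃₂ λ j₁ j₂ → 1 ≤ j₁ × 1 ≤ j₂ × j₁ + s₂ ≤ p × j₂ + s₃ ≤ q × j₁ + j₂ + k ≡ c
split-long-cycle {k = k} {s₂} {s₃} s₂<p s₃<q k+2≤c total
  with m≤n⇒∃[o]m+o≡n s₂<p | m≤n⇒∃[o]m+o≡n s₃<q | m≤n⇒∃[o]m+o≡n k+2≤c
... | a , refl | b , refl | t , refl with t ≤? a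
...   | yes t≤a = suc t , 1 , s≤s z≤n , s≤s z≤n , suc-+-swap-≤ s₂ t≤a , suc-+-swap-≤ s₃ z≤n , e₁ t k
  where
  e₁ : ∀ t k → suc t + 1 + k ≡ 2 + k + t
  e₁ = solve-∀
...   | no t≰a with m≤n⇒∃[o]m+o≡n (<⇒≤ (≰⇒> t≰a))
...     | u , refl = suc a , suc u , s≤s z≤n , s≤s z≤n , suc-+-swap-≤ s₂ ≤-refl , suc-+-swap-≤ s₃ (+-cancelˡ-≤ a u b t≤a+b) , e₂ a u k
  where
  e₂ : ∀ a u k → suc a + suc u + k ≡ 2 + k + (a + u)
  e₂ = solve-∀
  e₃ : ∀ s₂ s₃ k t → s₂ + s₃ + (2 + k + t) ≡ (s₂ + s₃ + 2 + k) + t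
  e₃ = solve-∀
  e₄ : ∀ s₂ s₃ k a b → suc s₂ + a + (suc s₃ + b) + k ≡ (s₂ + s₃ + 2 + k) + (a + b)
  e₄ = solve-∀
  t≤a+b : a + u ≤ a + b
  t≤a+b = +-cancelˡ-≤ (s₂ + s₃ + 2 + k) _ _
    (subst₂ _≤_ (e₃ s₂ s₃ k (a + u)) (e₄ s₂ s₃ k a b) total)

leftover-small : ∀ {p q r k M s₁ s₂ s₃} → r + 2 * k ≤ M → s₁ + s₂ + s₃ ≤ p + q + r →
  M ≤ s₁ + k → p ≤ s₂ + k → s₃ ≤ q
leftover-small {p} {q} {r} {k} {M} {s₁} {s₂} {s₃} r+2k≤M total M≤ p≤ =
  +-cancelʳ-≤ (M + p) s₃ q (begin
    s₃ + (M + p)                  ≤⟨ +-monoʳ-≤ s₃ (+-mono-≤ M≤ p≤) ⟩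
    s₃ + (s₁ + k + (s₂ + k))      ≡⟨ e₁ s₁ s₂ s₃ k ⟩
    s₁ + s₂ + s₃ + 2 * k          ≤⟨ +-monoˡ-≤ (2 * k) total ⟩
    p + q + r + 2 * k             ≡⟨ e₂ p q r k ⟩
    q + (r + 2 * k) + p           ≤⟨ +-monoˡ-≤ p (+-monoʳ-≤ q r+2k≤M) ⟩
    q + M + p                     ≡⟨ +-assoc q M p ⟩
    q + (M + p)                   ∎)
  where
  open ≤-Reasoning
  e₁ : ∀ s₁ s₂ s₃ k → s₃ + (s₁ + k + (s₂ + k)) ≡ s₁ + s₂ + s₃ + 2 * k
  e₁ = solve-∀
  e₂ : ∀ p q r k → p + q + r + 2 * k ≡ q + (r + 2 * k) + p
  e₂ = solve-∀

leftover-large : ∀ {p q r M s₁ s₂ s₃ x y c} → x + r ≤ M → y ≤ c → s₁ + s₂ + s₃ + c ≤ p + q + r →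
  M < s₁ + x → p ≤ s₂ + y → s₃ < q
leftover-large {p} {q} {r} {M} {s₁} {s₂} {s₃} {x} {y} {c} x+r≤M y≤c total M< p≤ =
  +-cancelʳ-≤ (M + p + c) (suc s₃) q (begin
    suc s₃ + (M + p + c)          ≡⟨ e₁ s₃ M p c ⟩
    s₃ + (suc M + p) + c          ≤⟨ +-monoˡ-≤ c (+-monoʳ-≤ s₃ (+-mono-≤ M< p≤)) ⟩
    s₃ + (s₁ + x + (s₂ + y)) + c  ≡⟨ e₂ s₁ s₂ s₃ x y c ⟩
    (s₁ + s₂ + s₃ + c) + x + y    ≤⟨ +-mono-≤ (+-monoˡ-≤ x total) y≤c ⟩
    p + q + r + x + c             ≡⟨ e₃ p q r x c ⟩
    p + q + (x + r) + c           ≤⟨ +-monoˡ-≤ c (+-monoʳ-≤ (p + q) x+r≤M) ⟩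
    p + q + M + c                 ≡⟨ e₄ p q M c ⟩
    q + (M + p + c)               ∎)
  where
  open ≤-Reasoning
  e₁ : ∀ s₃ M p c → suc s₃ + (M + p + c) ≡ s₃ + (suc M + p) + c
  e₁ = solve-∀
  e₂ : ∀ s₁ s₂ s₃ x y c → s₃ + (s₁ + x + (s₂ + y)) + c ≡ (s₁ + s₂ + s₃ + c) + x + y
  e₂ = solve-∀
  e₃ : ∀ p q r x c → p + q + r + x + c ≡ p + q + (x + r) + c
  e₃ = solve-∀
  e₄ : ∀ p q M c → p + q + M + c ≡ q + (M + p + c)
  e₄ = solve-∀

three-large-impossible : ∀ {M x y c} → M < x → x ≤ y → x ≤ c → ¬ (x + y + c ≤ 3 * M)
three-large-impossible {M} {x} {y} {c} M<x x≤y x≤c total = <⇒≱ (*-monoʳ-< 3 (n<1+n M)) (begin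
  3 * suc M    ≤⟨ *-monoʳ-≤ 3 M<x ⟩
  3 * x        ≡⟨ e x ⟩
  x + x + x    ≤⟨ +-mono-≤ (+-monoʳ-≤ x x≤y) x≤c ⟩
  x + y + c    ≤⟨ total ⟩
  3 * M        ∎)
  where
  open ≤-Reasoning
  e : ∀ x → 3 * x ≡ x + x + x
  e = solve-∀

four-large-impossible : ∀ {M r x y z c} → 6 ≤ M → r ≤ 2 → M < x + r → x ≤ y → x ≤ z → x ≤ c →
  ¬ (x + y + z + c ≤ 3 * M)
four-large-impossible {M} {r} {x} {y} {z} {c} 6≤M r≤2 M<x+r x≤y x≤z x≤c total =
  ≤⇒≯ (+-cancelʳ-≤ (3 * M + 4) M 4 (begin
    M + (3 * M + 4)       ≡⟨ e₁ M ⟩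
    4 * suc M             ≤⟨ *-monoʳ-≤ 4 M<x+r ⟩
    4 * (x + r)           ≡⟨ e₂ x r ⟩
    x + x + x + x + 4 * r ≤⟨ +-mono-≤ (+-mono-≤ (+-mono-≤ (+-monoʳ-≤ x x≤y) x≤z) x≤c) (*-monoʳ-≤ 4 r≤2) ⟩
    x + y + z + c + 8     ≤⟨ +-monoˡ-≤ 8 total ⟩
    3 * M + 8             ≡⟨ e₃ M ⟩
    4 + (3 * M + 4)       ∎)) (≤-trans (n≤1+n 5) 6≤M)
  where
  open ≤-Reasoning
  e₁ : ∀ M → M + (3 * M + 4) ≡ 4 * suc M
  e₁ = solve-∀
  e₂ : ∀ x r → 4 * (x + r) ≡ x + x + x + x + 4 * r
  e₂ = solve-∀
  e₃ : ∀ M → 3 * M + 8 ≡ 4 + (3 * M + 4)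
  e₃ = solve-∀

rest-bound : ∀ {p q r s t} → r ≤ 2 → 2 ≤ s → s + t ≤ p + q + r → t ≤ p + q
rest-bound {p} {q} {r} {s} {t} r≤2 2≤s total = +-cancelʳ-≤ 2 t (p + q) (begin
  t + 2          ≤⟨ +-monoʳ-≤ t 2≤s ⟩
  t + s          ≡⟨ +-comm t s ⟩
  s + t          ≤⟨ total ⟩
  p + q + r      ≤⟨ +-monoʳ-≤ (p + q) r≤2 ⟩
  p + q + 2      ∎)
  where open ≤-Reasoning

forced-near-pair : ∀ {p q r x c} → p ≤ q → q ≤ x → x + c ≤ p + q + r → c ≤ x + r
forced-near-pair {p} {q} {r} {x} {c} p≤q q≤x total = +-cancelˡ-≤ x c (x + r) (begin
  x + c          ≤⟨ total ⟩
  p + q + r      ≤⟨ +-monoˡ-≤ r (+-mono-≤ (≤-trans p≤q q≤x) q≤x) ⟩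
  x + x + r      ≡⟨ +-assoc x x r ⟩
  x + (x + r)    ∎)
  where open ≤-Reasoning

larger-fits-first : ∀ {p q x c} → q ≤ x → x + c ≤ p + q → c ≤ p
larger-fits-first {p} {q} {x} {c} q≤x total = +-cancelʳ-≤ q c p (begin
  c + q          ≤⟨ +-monoʳ-≤ c q≤x ⟩
  c + x          ≡⟨ +-comm c x ⟩
  x + c          ≤⟨ total ⟩
  p + q          ∎)
  where open ≤-Reasoning

middle-fits-second : ∀ {p q x y c} → 1 ≤ x → y ≤ c → p ≤ q → x + y + c ≤ p + q → y < q
middle-fits-second {p} {q} {x} {y} {c} 1≤x y≤c p≤q total = *-cancelˡ-< 2 y q (begin-strict
  2 * y          ≡⟨ e y ⟩
  0 + y + y      <⟨ +-monoˡ-< y (+-monoˡ-< y 1≤x) ⟩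
  x + y + y      ≤⟨ +-monoʳ-≤ (x + y) y≤c ⟩
  x + y + c      ≤⟨ total ⟩
  p + q          ≤⟨ +-monoˡ-≤ q p≤q ⟩
  q + q          ≡⟨ e q ⟨
  2 * q          ∎)
  where
  open ≤-Reasoning
  e : ∀ n → 2 * n ≡ 0 + n + n
  e = solve-∀

tail-fits-second : ∀ {p q x y c} → p ≤ x → x + y + c ≤ p + q → y + c ≤ q
tail-fits-second {p} {q} {x} {y} {c} p≤x total = +-cancelˡ-≤ p (y + c) q (begin
  p + (y + c)    ≤⟨ +-monoˡ-≤ (y + c) p≤x ⟩
  x + (y + c)    ≡⟨ +-assoc x y c ⟨
  x + y + c      ≤⟨ total ⟩
  p + q          ∎)
  where open ≤-Reasoning

head-fits-second : ∀ {p q x y c} → p < x → x ≤ c → x + y + c ≤ p + q → x + y < q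
head-fits-second {p} {q} {x} {y} {c} p<x x≤c total = +-cancelˡ-≤ p (suc (x + y)) q (begin
  p + suc (x + y) ≡⟨ +-comm p _ ⟩
  suc (x + y) + p ≡⟨ +-suc (x + y) p ⟨
  x + y + suc p   ≤⟨ +-monoʳ-≤ (x + y) (≤-trans p<x x≤c) ⟩
  x + y + c       ≤⟨ total ⟩
  p + q           ∎)
  where open ≤-Reasoning

module _ {p q k M r : ℕ} (1≤r : 1 ≤ r) (r≤2 : r ≤ 2) (r≤k : r ≤ k) (1≤p : 1 ≤ p) (p≤q : p ≤ q)
         (2k+4≤M : 2 * k + 4 ≤ M) where

  private
    r+2k≤M : r + 2 * k ≤ M
    r+2k≤M = ≤-trans (≤-reflexive (+-comm r (2 * k))) (≤-trans (+-monoʳ-≤ (2 * k) (≤-trans r≤2 (s≤s (s≤s z≤n)))) 2k+4≤M)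

    6≤M : 6 ≤ M
    6≤M = ≤-trans (+-monoˡ-≤ 4 (*-monoʳ-≤ 2 (≤-trans 1≤r r≤k))) 2k+4≤M

    1≤q : 1 ≤ q
    1≤q = ≤-trans 1≤p p≤q

    suc[p∸1]≡p : suc (p ∸ 1) ≡ p
    suc[p∸1]≡p = trans (+-comm 1 (p ∸ 1)) (m∸n+n≡m 1≤p)

    tripleFits : ∀ Y₁ {x y c} → 2 ≤ sum Y₁ → sum ((Y₁ ++ x ∷ [ y ]) ∷ʳ c) ≤ p + q + r → x + y + c ≤ p + q
    tripleFits Y₁ {x} {y} {c} 2≤s total = rest-bound {p} {q} r≤2 2≤s
      (subst (_≤ p + q + r) (trans (sum-++-∷ʳ Y₁ (x ∷ [ y ]) c) (e (sum Y₁) x y c)) total)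
      where
      e : ∀ s x y c → s + (x + (y + 0)) + c ≡ s + (x + y + c)
      e = solve-∀

  layoutSmall : ∀ ns → All (_≤ suc k) ns → sum ns ≤ p + q + r → Layout p q k M ns
  layoutSmall ns small total with greedyPrefix M ns
  ... | prefix Y₁ Z refl fits₁ sat₁ with greedyPrefix p Z
  ...   | prefix Y₂ Y₃ refl fits₂ sat₂ = inLadders Y₁ Y₂ Y₃ refl fits₁ fits₂
    (leftover (saturated-small (Allₚ.++⁻ʳ Y₁ small) sat₁) (saturated-small (Allₚ.++⁻ʳ Y₂ (Allₚ.++⁻ʳ Y₁ small)) sat₂))
    where
    leftover : Y₂ ++ Y₃ ≡ [] ⊎ M ≤ sum Y₁ + k → Y₃ ≡ [] ⊎ p ≤ sum Y₂ + k → sum Y₃ ≤ q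
    leftover _          (inj₁ Y₃≡[]) = subst (λ Y → sum Y ≤ q) (sym Y₃≡[]) z≤n
    leftover (inj₁ Z≡[]) _           = subst (λ Y → sum Y ≤ q) (sym (++-conicalʳ Y₂ Y₃ Z≡[])) z≤n
    leftover (inj₂ M≤)  (inj₂ p≤)    =
      leftover-small {k = k} {s₁ = sum Y₁} {s₂ = sum Y₂} r+2k≤M (subst (_≤ p + q + r) (sum-++₃ Y₁ Y₂ Y₃) total) M≤ p≤

  viaLongCycle : ∀ {ns} Y₁ Y₂ Y₃ c → ns ≡ Y₁ ++ Y₂ ++ Y₃ ∷ʳ c → sum ns ≤ p + q + r → 2 + k ≤ c →
                 sum Y₁ ≤ M → sum Y₂ < p → sum Y₃ < q → Layout p q k M ns
  viaLongCycle Y₁ Y₂ Y₃ c refl total k+2≤c fits₁ fits₂ fits₃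
    with split-long-cycle fits₂ fits₃ k+2≤c (≤-trans (+-monoˡ-≤ c (+-monoˡ-≤ (sum Y₃) (m≤n+m (sum Y₂) (sum Y₁))))
           (≤-trans (≤-reflexive (sym (sum-++₃-∷ʳ Y₁ Y₂ Y₃ c))) (≤-trans total (+-monoʳ-≤ (p + q) r≤k))))
  ... | j₁ , j₂ , 1≤j₁ , 1≤j₂ , room₂ , room₃ , refl = withLongCycle Y₁ Y₂ Y₃ j₁ j₂ refl fits₁ room₂ room₃ 1≤j₁ 1≤j₂

  pairOverflow : ∀ Y₁ x c → 2 + k ≤ c → All (2 ≤_) Y₁ → x ≤ c → sum ((Y₁ ++ [ x ]) ∷ʳ c) ≤ p + q + r →
                 ¬ NearPair r ((Y₁ ++ [ x ]) ∷ʳ c) → sum Y₁ ≤ M → Layout p q k M ((Y₁ ++ [ x ]) ∷ʳ c)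
  pairOverflow Y₁ x c k+2≤c big x≤c total far fits₁ with x <? p | x <? q
  ... | yes x<p | _       = viaLongCycle Y₁ [ x ] [] c (++-assoc Y₁ [ x ] [ c ]) total k+2≤c fits₁
                              (subst (_< p) (sym (+-identityʳ x)) x<p) 1≤q
  ... | no _    | yes x<q = viaLongCycle Y₁ [] [ x ] c (++-assoc Y₁ [ x ] [ c ]) total k+2≤c fits₁
                              1≤p (subst (_< q) (sym (+-identityʳ x)) x<q)
  ... | no _    | no x≮q  = bothInLadders Y₁ big total far fits₁
    where
    q≤x : q ≤ x
    q≤x = ≮⇒≥ x≮q
    sum-pair : ∀ Y₁ → sum ((Y₁ ++ [ x ]) ∷ʳ c) ≡ sum Y₁ + (x + c)
    sum-pair Y₁ = trans (sum-++-∷ʳ Y₁ [ x ] c) (e (sum Y₁) x c)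
      where
      e : ∀ s x c → s + (x + 0) + c ≡ s + (x + c)
      e = solve-∀
    bothInLadders : ∀ Y₁ → All (2 ≤_) Y₁ → sum ((Y₁ ++ [ x ]) ∷ʳ c) ≤ p + q + r →
                    ¬ NearPair r ((Y₁ ++ [ x ]) ∷ʳ c) → sum Y₁ ≤ M → Layout p q k M ((Y₁ ++ [ x ]) ∷ʳ c)
    bothInLadders [] _ total far _ =
      ⊥-elim (far (x , c , refl , forced-near-pair p≤q q≤x (subst (_≤ p + q + r) (sum-pair []) total)))
    bothInLadders Y₁@(a ∷ _) (2≤a ∷ _) total _ fits₁ =
      inLadders Y₁ [ x ] [ c ] (++-assoc Y₁ [ x ] [ c ]) fits₁
        (subst (_≤ p) (sym (+-identityʳ x)) (≤-trans x≤c c≤p)) (subst (_≤ q) (sym (+-identityʳ c)) (≤-trans c≤p p≤q))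
      where
      c≤p : c ≤ p
      c≤p = larger-fits-first q≤x
        (rest-bound {p} {q} r≤2 (≤-trans 2≤a (m≤m+n a _)) (subst (_≤ p + q + r) (sum-pair Y₁) total))

  tripleOverflow : ∀ Y₁ x y c → 2 + k ≤ c → 1 ≤ x → x ≤ c → y ≤ c → x + y + c ≤ p + q →
                   sum ((Y₁ ++ x ∷ [ y ]) ∷ʳ c) ≤ p + q + r → sum Y₁ ≤ M → Layout p q k M ((Y₁ ++ x ∷ [ y ]) ∷ʳ c)
  tripleOverflow Y₁ x y c k+2≤c 1≤x x≤c y≤c triple total fits₁ with x <? p | x ≤? p
  ... | yes x<p | _       = viaLongCycle Y₁ [ x ] [ y ] c (++-assoc Y₁ (x ∷ [ y ]) [ c ]) total k+2≤c fits₁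
                              (subst (_< p) (sym (+-identityʳ x)) x<p)
                              (subst (_< q) (sym (+-identityʳ y)) (middle-fits-second 1≤x y≤c p≤q triple))
  ... | no x≮p  | yes x≤p = inLadders Y₁ [ x ] (y ∷ [ c ]) (++-assoc Y₁ (x ∷ [ y ]) [ c ]) fits₁
                              (subst (_≤ p) (sym (+-identityʳ x)) x≤p)
                              (subst (_≤ q) (cong (y +_) (sym (+-identityʳ c))) (tail-fits-second (≮⇒≥ x≮p) triple))
  ... | no _    | no x≰p  = viaLongCycle Y₁ [] (x ∷ [ y ]) c (++-assoc Y₁ (x ∷ [ y ]) [ c ]) total k+2≤c fits₁ 1≤p
                              (subst (_< q) (cong (x +_) (sym (+-identityʳ y))) (head-fits-second (≰⇒> x≰p) x≤c triple))

  largeOverflow : ∀ Y₁ x Z c → 2 + k ≤ c → All (2 ≤_) Y₁ → 1 ≤ x → AllPairs _≤_ (x ∷ Z ∷ʳ c) →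
                  sum ((Y₁ ++ x ∷ Z) ∷ʳ c) ≤ p + q + r → sum ((Y₁ ++ x ∷ Z) ∷ʳ c) ≤ 3 * M →
                  ¬ NearPair r ((Y₁ ++ x ∷ Z) ∷ʳ c) → sum Y₁ ≤ M → M < sum Y₁ + x → M < x + r →
                  Layout p q k M ((Y₁ ++ x ∷ Z) ∷ʳ c)
  largeOverflow Y₁ x [] c k+2≤c big _ ((x≤c ∷ []) ∷ _) total _ far fits₁ _ _ =
    pairOverflow Y₁ x c k+2≤c big x≤c total far fits₁
  largeOverflow [] x (y ∷ []) c _ _ _ ((x≤y ∷ x≤c ∷ []) ∷ _) _ bounded _ _ M<x _ =
    ⊥-elim (three-large-impossible M<x x≤y x≤c (subst (_≤ 3 * M) (e x y c) bounded))
    where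
    e : ∀ x y c → x + (y + (c + 0)) ≡ x + y + c
    e = solve-∀
  largeOverflow Y₁@(a ∷ _) x (y ∷ []) c k+2≤c (2≤a ∷ _) 1≤x ((_ ∷ x≤c ∷ []) ∷ (y≤c ∷ []) ∷ _) total _ _ fits₁ _ _ =
    tripleOverflow Y₁ x y c k+2≤c 1≤x x≤c y≤c (tripleFits Y₁ (≤-trans 2≤a (m≤m+n a _)) total) total fits₁
  largeOverflow Y₁ x (y ∷ z ∷ Z) c _ _ _ ((x≤y ∷ x≤z ∷ x≤rest) ∷ _) _ bounded _ _ _ M<x+r =
    ⊥-elim (four-large-impossible 6≤M r≤2 M<x+r x≤y x≤z (proj₂ (Allₚ.∷ʳ⁻ x≤rest)) (≤-trans four≤sum bounded))
    where
    four≤sum : x + y + z + c ≤ sum ((Y₁ ++ x ∷ y ∷ z ∷ Z) ∷ʳ c)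
    four≤sum = ≤-trans (≤-trans (≤-reflexive (e x y z c)) (+-monoʳ-≤ (x + (y + z)) (m≤n+m c (sum Z + sum Y₁))))
      (≤-reflexive (sym (trans (sum-++-∷ʳ Y₁ (x ∷ y ∷ z ∷ Z) c) (f (sum Y₁) x y z (sum Z) c))))
      where
      e : ∀ x y z c → x + y + z + c ≡ x + (y + z) + c
      e = solve-∀
      f : ∀ s x y z t c → s + (x + (y + (z + t))) + c ≡ x + (y + z) + (t + s + c)
      f = solve-∀

  -- The largest length c ≥ k + 2 becomes the long cycle and the others are filled greedily into the
  -- spare ladder and L_{n₁} minus one rung; only when the first length x left over by the spare ladder
  -- has x + r > M is something else needed, and then at most three lengths from x on exist.
  layoutLarge : ∀ R c → 2 + k ≤ c → All (2 ≤_) (R ∷ʳ c) → AllPairs _≤_ (R ∷ʳ c) →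
                sum (R ∷ʳ c) ≤ p + q + r → sum (R ∷ʳ c) ≤ 3 * M → ¬ NearPair r (R ∷ʳ c) → Layout p q k M (R ∷ʳ c)
  layoutLarge R c k+2≤c big sorted total bounded far with greedyPrefix M R
  ... | prefix Y₁ [] refl fits₁ _ =
    viaLongCycle Y₁ [] [] c (++-assoc Y₁ [] [ c ]) total k+2≤c fits₁ 1≤p 1≤q
  ... | prefix Y₁ (x ∷ Z) refl fits₁ sat₁ with x + r ≤? M
  ...   | no x+r≰M =
    largeOverflow Y₁ x Z c k+2≤c (Allₚ.++⁻ˡ Y₁ bigR) (≤-trans (s≤s z≤n) (All.head (Allₚ.++⁻ʳ Y₁ bigR)))
      (AllPairs-++⁻ʳ Y₁ (subst (AllPairs _≤_) (++-assoc Y₁ (x ∷ Z) [ c ]) sorted)) total bounded far fits₁ sat₁ (≰⇒> x+r≰M)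
    where
    bigR : All (2 ≤_) (Y₁ ++ x ∷ Z)
    bigR = proj₁ (Allₚ.∷ʳ⁻ big)
  ...   | yes x+r≤M with greedyPrefix (p ∸ 1) (x ∷ Z)
  ...     | prefix Y₂ Y₃ split₂ fits₂ sat₂ =
    viaLongCycle Y₁ Y₂ Y₃ c regroup total k+2≤c fits₁ (≤-trans (s≤s fits₂) (≤-reflexive suc[p∸1]≡p)) (leftover Y₃ regroup sat₂ belowC)
    where
    regroup : (Y₁ ++ x ∷ Z) ∷ʳ c ≡ Y₁ ++ Y₂ ++ Y₃ ∷ʳ c
    regroup = trans (cong (λ X → (Y₁ ++ X) ∷ʳ c) split₂) (++-∷ʳ-assoc Y₁ Y₂ Y₃ c)
    belowC : All (_≤ c) Y₃
    belowC = Allₚ.++⁻ʳ Y₂ (subst (All (_≤ c)) split₂ (Allₚ.++⁻ʳ Y₁ (AllPairs-∷ʳ⁻ (Y₁ ++ x ∷ Z) sorted)))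
    leftover : ∀ Y₃ → (Y₁ ++ x ∷ Z) ∷ʳ c ≡ Y₁ ++ Y₂ ++ Y₃ ∷ʳ c → Saturated (p ∸ 1) Y₂ Y₃ → All (_≤ c) Y₃ → sum Y₃ < q
    leftover []      _  _         _          = 1≤q
    leftover (y ∷ Y) eq p∸1<Y₂+y (y≤c ∷ _) =
      leftover-large {p = p} x+r≤M y≤c (subst (_≤ p + q + r) (trans (cong sum eq) (sum-++₃-∷ʳ Y₁ Y₂ (y ∷ Y) c)) total) sat₁
        (≤-trans (≤-reflexive (sym suc[p∸1]≡p)) p∸1<Y₂+y)

  layout : ∀ ns → All (2 ≤_) ns → AllPairs _≤_ ns → sum ns ≤ p + q + r → sum ns ≤ 3 * M → ¬ NearPair r ns →
           Layout p q k M ns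
  layout ns big sorted total bounded far with reverseView ns
  ... | [] = inLadders [] [] [] refl z≤n z≤n z≤n
  ... | R ∶ _ ∶ʳ c with c ≤? suc k
  ...   | yes c≤1+k = layoutSmall (R ∷ʳ c) (Allₚ.∷ʳ⁺ (All.map (λ x≤c → ≤-trans x≤c c≤1+k) (AllPairs-∷ʳ⁻ R sorted)) c≤1+k) total
  ...   | no c≰1+k = layoutLarge R c (≰⇒> c≰1+k) big sorted total bounded far

-- Coordinates on the ladders and the connecting paths

data Side : Set where
  upper lower : Side

data LadderId : Set where
  first second spare : LadderId

data Part : Set where
  rail : LadderId → Side → Part
  link : Side → Part

-- (t , i) stands for the i-th vertex of the part t: the a-rail (upper) or b-rail (lower) of one of
-- the three ladders, or the interior of a connecting path (link upper = P1, link lower = P2).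
Coord : Set
Coord = Part × ℕ

data OnRungs (ℓ : LadderId) (lo hi : ℕ) : Pred Coord 0ℓ where
  onRung : ∀ s {i} → lo ≤ i → i < hi → OnRungs ℓ lo hi (rail ℓ s , i)

data OnLink (s : Side) : Pred Coord 0ℓ where
  onLink : ∀ i → OnLink s (link s , i)

rungs-⊆ : ∀ {ℓ lo hi lo′ hi′} → lo′ ≤ lo → hi ≤ hi′ → OnRungs ℓ lo hi ⊆ OnRungs ℓ lo′ hi′
rungs-⊆ lo′≤lo hi≤hi′ (onRung s lo≤i i<hi) = onRung s (≤-trans lo′≤lo lo≤i) (≤-trans i<hi hi≤hi′)

rungs-⊥-ladders : ∀ {ℓ ℓ′ lo hi lo′ hi′} → ℓ ≢ ℓ′ → OnRungs ℓ lo hi ⊥ OnRungs ℓ′ lo′ hi′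
rungs-⊥-ladders ℓ≢ℓ (onRung _ _ _ , onRung _ _ _) = ℓ≢ℓ refl

rungs-⊥-below : ∀ {ℓ ℓ′ lo hi lo′ hi′} → hi ≤ lo′ → OnRungs ℓ lo hi ⊥ OnRungs ℓ′ lo′ hi′
rungs-⊥-below hi≤lo′ (onRung _ _ i<hi , onRung _ lo′≤i _) = <⇒≱ i<hi (≤-trans hi≤lo′ lo′≤i)

rungs-⊥-link : ∀ {ℓ lo hi s} → OnRungs ℓ lo hi ⊥ OnLink s
rungs-⊥-link (onRung _ _ _ , ())

OnLongCycle : ℕ → ℕ → Pred Coord 0ℓ
OnLongCycle j₁ j₂ = OnRungs first 0 j₁ ∪ OnLink upper ∪ OnRungs second 0 j₂ ∪ OnLink lower

rungs-⊥-longCycle : ∀ {ℓ lo hi j₁ j₂} → (ℓ ≡ first → j₁ ≤ lo) → (ℓ ≡ second → j₂ ≤ lo) → OnRungs ℓ lo hi ⊥ OnLongCycle j₁ j₂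
rungs-⊥-longCycle j₁≤lo _ (onRung _ lo≤i _ , inj₁ (onRung _ _ i<j₁))                = <⇒≱ i<j₁ (≤-trans (j₁≤lo refl) lo≤i)
rungs-⊥-longCycle _ _     (onRung _ _ _ , inj₂ (inj₁ ()))
rungs-⊥-longCycle _ j₂≤lo (onRung _ lo≤i _ , inj₂ (inj₂ (inj₁ (onRung _ _ i<j₂)))) = <⇒≱ i<j₂ (≤-trans (j₂≤lo refl) lo≤i)
rungs-⊥-longCycle _ _     (onRung _ _ _ , inj₂ (inj₂ (inj₂ ())))

rail-≢ : ∀ {ℓ s t} {i j : ℕ} → s ≢ t → _≢_ {A = Coord} (rail ℓ s , i) (rail ℓ t , j)
rail-≢ s≢t refl = s≢t refl

below-rungs-≢ : ∀ {ℓ lo hi p} {i : ℕ} {v : Coord} → i < lo → OnRungs ℓ lo hi v → _≢_ {A = Coord} (p , i) v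
below-rungs-≢ i<lo (onRung _ lo≤j _) refl = <⇒≱ i<lo lo≤j

module _ (ℓ : LadderId) where

  -- zigzag s t i c leads from (s , i) to (t , i) through all vertices of rungs i+1, …, i+c of ladder ℓ,
  -- switching rails at every step; closed by the rung i it becomes the rung cycle on rungs i, …, i+c.
  zigzag : Side → Side → ℕ → ℕ → List Coord
  zigzag s t i zero    = []
  zigzag s t i (suc c) = (rail ℓ t , suc i) ∷ zigzag t s (suc i) c ++ [ rail ℓ s , suc i ]

  rungCycle : Side → Side → ℕ → ℕ → List Coord
  rungCycle s t i c = (rail ℓ s , i) ∷ zigzag s t i c ++ [ rail ℓ t , i ]

  zigzag-length    : ∀ s t i c → length (zigzag s t i c) ≡ 2 * c
  rungCycle-length : ∀ s t i c → length (rungCycle s t i c) ≡ 2 * suc c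

  zigzag-length s t i zero    = refl
  zigzag-length s t i (suc c) = rungCycle-length t s (suc i) c

  rungCycle-length s t i c = begin
    suc (length (zigzag s t i c ++ [ rail ℓ t , i ])) ≡⟨ cong suc (length-++ (zigzag s t i c)) ⟩
    suc (length (zigzag s t i c) + 1)               ≡⟨ cong (λ n → suc (n + 1)) (zigzag-length s t i c) ⟩
    suc (2 * c + 1)                                 ≡⟨ e c ⟩
    2 * suc c                                       ∎
    where
    open ≡-Reasoning
    e : ∀ c → suc (2 * c + 1) ≡ 2 * suc c
    e = solve-∀

  zigzag-onRungs    : ∀ s t i c → All (OnRungs ℓ (suc i) (suc (i + c))) (zigzag s t i c)
  rungCycle-onRungs : ∀ s t i c → All (OnRungs ℓ i (suc (i + c))) (rungCycle s t i c)

  zigzag-onRungs s t i zero    = []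
  zigzag-onRungs s t i (suc c) =
    All.map (rungs-⊆ ≤-refl (≤-reflexive (cong suc (sym (+-suc i c))))) (rungCycle-onRungs t s (suc i) c)

  rungCycle-onRungs s t i c = onRung s ≤-refl i<end ∷
    Allₚ.++⁺ (All.map (rungs-⊆ (n≤1+n i) ≤-refl) (zigzag-onRungs s t i c)) (onRung t ≤-refl i<end ∷ [])
    where
    i<end : i < suc (i + c)
    i<end = s≤s (m≤m+n i c)

  zigzag-unique    : ∀ s t i c → s ≢ t → Unique (zigzag s t i c)
  rungCycle-unique : ∀ s t i c → s ≢ t → Unique (rungCycle s t i c)

  zigzag-unique s t i zero    _   = []
  zigzag-unique s t i (suc c) s≢t = rungCycle-unique t s (suc i) c (λ t≡s → s≢t (sym t≡s))

  rungCycle-unique s t i c s≢t = unique-enclose (rail-≢ s≢t)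
    (All.map (below-rungs-≢ ≤-refl) (zigzag-onRungs s t i c))
    (All.map (λ v∈ v≡ → below-rungs-≢ ≤-refl v∈ (sym v≡)) (zigzag-onRungs s t i c))
    (zigzag-unique s t i c s≢t)

-- Cycles of G from a layout

module Embedding {N : ℕ} (G : Graph N) {n' k n'' : ℕ} (W : WeakLadder G n' k) (L : Ladder G n'')
                 (all-distinct : Unique (weakLadderVerts G W ++ ladderVerts G L)) where

  open Graph G using (Adj) renaming (sym to Adj-sym)
  open WeakLadder W using (m1; m2; L1; L2; P1; P2; path1; path2; interiorSize)

  rungs : LadderId → ℕ
  rungs first  = suc m1
  rungs second = suc m2
  rungs spare  = n''

  ladder : ∀ ℓ → Ladder G (rungs ℓ)
  ladder first  = L1
  ladder second = L2
  ladder spare  = L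

  partVertices : Part → List (Fin N)
  partVertices (rail ℓ upper) = tabulate (Ladder.a (ladder ℓ))
  partVertices (rail ℓ lower) = tabulate (Ladder.b (ladder ℓ))
  partVertices (link upper)   = P1
  partVertices (link lower)   = P2

  parts : List Part
  parts = rail first upper ∷ rail first lower ∷ rail second upper ∷ rail second lower ∷
          link upper ∷ link lower ∷ rail spare upper ∷ rail spare lower ∷ []

  part∈parts : ∀ t → t ∈ parts
  part∈parts (rail first upper)  = here refl
  part∈parts (rail first lower)  = there (here refl)
  part∈parts (rail second upper) = there (there (here refl))
  part∈parts (rail second lower) = there (there (there (here refl)))
  part∈parts (link upper)        = there (there (there (there (here refl))))
  part∈parts (link lower)        = there (there (there (there (there (here refl)))))
  part∈parts (rail spare upper)  = there (there (there (there (there (there (here refl))))))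
  part∈parts (rail spare lower)  = there (there (there (there (there (there (there (here refl)))))))

  parts-distinct : Unique (concat (map partVertices parts))
  parts-distinct = subst Unique (reassociate (partVertices (rail first upper)) (partVertices (rail first lower))
    (partVertices (rail second upper)) (partVertices (rail second lower)) P1 P2
    (partVertices (rail spare upper)) (partVertices (rail spare lower))) all-distinct
    where
    reassociate : ∀ (a b c d e f g h : List (Fin N)) →
      ((a ++ b) ++ ((c ++ d) ++ (e ++ f))) ++ (g ++ h) ≡ a ++ b ++ c ++ d ++ e ++ f ++ g ++ h ++ []
    reassociate a b c d e f g h = solve (++-monoid (Fin N))

  -- The default vertex is junk: φ is only ever applied to Valid coordinates.
  φ : Coord → Fin N
  φ (t , i) = nth (Ladder.a L1 fzero) (partVertices t) i

  Valid : Pred Coord 0ℓ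
  Valid (t , i) = i < length (partVertices t)

  φ-injective : ∀ {u v} → Valid u → Valid v → φ u ≡ φ v → u ≡ v
  φ-injective {t , _} {t′ , _} = concat-coordinate-injective _ partVertices parts-distinct (part∈parts t) (part∈parts t′)

  E : Coord → Coord → Set
  E u v = Adj (φ u) (φ v)

  rungs-valid : ∀ {ℓ lo hi} → hi ≤ rungs ℓ → OnRungs ℓ lo hi ⊆ Valid
  rungs-valid {ℓ} hi≤ (onRung upper _ i<hi) = subst (_ <_) (sym (length-tabulate (Ladder.a (ladder ℓ)))) (≤-trans i<hi hi≤)
  rungs-valid {ℓ} hi≤ (onRung lower _ i<hi) = subst (_ <_) (sym (length-tabulate (Ladder.b (ladder ℓ)))) (≤-trans i<hi hi≤)

  ladder-edge : ∀ ℓ {i j} (i< : i < rungs ℓ) (j< : j < rungs ℓ) → i ≤ suc j → j ≤ suc i →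
                E (rail ℓ upper , i) (rail ℓ lower , j)
  ladder-edge ℓ i< j< i≤1+j j≤1+i = subst₂ Adj (sym (nth-tabulate _ _ i<)) (sym (nth-tabulate _ _ j<))
    (Ladder.edges (ladder ℓ) (fromℕ< i<) (fromℕ< j<)
      (subst₂ (λ a b → a ≤ suc b) (sym (toℕ-fromℕ< i<)) (sym (toℕ-fromℕ< j<)) i≤1+j)
      (subst₂ (λ a b → a ≤ suc b) (sym (toℕ-fromℕ< j<)) (sym (toℕ-fromℕ< i<)) j≤1+i))

  rail-edge : ∀ ℓ {s t} → s ≢ t → ∀ {i j} → i < rungs ℓ → j < rungs ℓ → i ≤ suc j → j ≤ suc i →
              E (rail ℓ s , i) (rail ℓ t , j)
  rail-edge ℓ {upper} {lower} _   = ladder-edge ℓ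
  rail-edge ℓ {lower} {upper} _   i< j< i≤1+j j≤1+i = Adj-sym (ladder-edge ℓ j< i< j≤1+i i≤1+j)
  rail-edge ℓ {upper} {upper} s≢s = ⊥-elim (s≢s refl)
  rail-edge ℓ {lower} {lower} s≢s = ⊥-elim (s≢s refl)

  zigzag-path : ∀ ℓ s t i c → s ≢ t → i + c < rungs ℓ → Path E (rail ℓ s , i) (zigzag ℓ s t i c) (rail ℓ t , i)
  zigzag-path ℓ s t i zero    s≢t i+0< = rail-edge ℓ s≢t i< i< (n≤1+n i) (n≤1+n i) ∷ [-]
    where
    i< : i < rungs ℓ
    i< = subst (_< rungs ℓ) (+-identityʳ i) i+0<
  zigzag-path ℓ s t i (suc c) s≢t i+1+c< =
    path-++ [] (rail-edge ℓ s≢t i< 1+i< (≤-trans (n≤1+n i) (n≤1+n (suc i))) ≤-refl ∷ [-])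
      (path-++ (zigzag ℓ t s (suc i) c) (zigzag-path ℓ t s (suc i) c (λ t≡s → s≢t (sym t≡s)) 1+i+c<)
        (rail-edge ℓ s≢t 1+i< i< ≤-refl (≤-trans (n≤1+n i) (n≤1+n (suc i))) ∷ [-]))
    where
    1+i+c< : suc i + c < rungs ℓ
    1+i+c< = subst (_< rungs ℓ) (+-suc i c) i+1+c<
    1+i< : suc i < rungs ℓ
    1+i< = ≤-trans (s≤s (s≤s (m≤m+n i c))) 1+i+c<
    i< : i < rungs ℓ
    i< = ≤-trans (n≤1+n (suc i)) 1+i<

  rungCycle-path : ∀ ℓ s t i c → s ≢ t → i + c < rungs ℓ →
                   Path E (rail ℓ s , i) (zigzag ℓ s t i c ++ [ rail ℓ t , i ]) (rail ℓ s , i)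
  rungCycle-path ℓ s t i c s≢t i+c< = path-++ (zigzag ℓ s t i c) (zigzag-path ℓ s t i c s≢t i+c<)
    (rail-edge ℓ (λ t≡s → s≢t (sym t≡s)) i< i< (n≤1+n i) (n≤1+n i) ∷ [-])
    where
    i< : i < rungs ℓ
    i< = ≤-trans (s≤s (m≤m+n i c)) i+c<

  cycle-image : ∀ {m v} W → Path E v W v → length (v ∷ W) ≡ m → 3 ≤ m → IsCycle G m (map φ (v ∷ W))
  cycle-image {v = v} W closed len 3≤m = trans (length-map φ (v ∷ W)) len , 3≤m , φ v , map φ W , refl ,
    subst (λ X → Linked Adj (φ v ∷ X)) (map-++ φ W [ v ]) (Linkedₚ.map⁺ {R = Adj} {f = φ} closed)

  linkCoords : Side → List Coord
  linkCoords s = applyUpTo (link s ,_) (length (partVertices (link s)))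

  link-path : ∀ s → Path E (rail first s , 0) (linkCoords s) (rail second s , 0)
  link-path s = Linkedₚ.map⁻ {R = Adj} {f = φ} (subst (Linked Adj) (sym image) (walk s))
    where
    walk : ∀ s → Linked Adj (φ (rail first s , 0) ∷ partVertices (link s) ++ [ φ (rail second s , 0) ])
    walk upper = path1
    walk lower = path2
    image : map φ ((rail first s , 0) ∷ linkCoords s ++ [ rail second s , 0 ]) ≡
            φ (rail first s , 0) ∷ partVertices (link s) ++ [ φ (rail second s , 0) ]
    image = cong (φ (rail first s , 0) ∷_) (trans (map-++ φ (linkCoords s) _)
      (cong (_++ [ φ (rail second s , 0) ]) (trans (map-applyUpTo _ φ _) (applyUpTo-nth _ (partVertices (link s))))))

  link-valid : ∀ s → All Valid (linkCoords s)
  link-valid s = Allₚ.applyUpTo⁺₁ _ _ id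

  link-uniqueIn : ∀ s → UniqueIn (OnLink s) (linkCoords s)
  link-uniqueIn s = Uniqueₚ.applyUpTo⁺₁ _ _ (λ i<j _ e → <⇒≢ i<j (cong proj₂ e)) , Allₚ.applyUpTo⁺₂ _ _ onLink

  reversedLowerLink : List Coord
  reversedLowerLink = applyDownFrom (link lower ,_) (length P2)

  reversedLowerLink-path : Path E (rail second lower , 0) reversedLowerLink (rail first lower , 0)
  reversedLowerLink-path = subst (λ V → Path E _ V _) (reverse-applyUpTo _ (length P2))
    (path-reverse Adj-sym (linkCoords lower) (link-path lower))

  reversedLowerLink-valid : All Valid reversedLowerLink
  reversedLowerLink-valid = Allₚ.applyDownFrom⁺₁ _ _ id

  reversedLowerLink-uniqueIn : UniqueIn (OnLink lower) reversedLowerLink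
  reversedLowerLink-uniqueIn = Uniqueₚ.applyDownFrom⁺₁ _ _ (λ j<i _ e → <⇒≢ j<i (sym (cong proj₂ e))) , Allₚ.applyDownFrom⁺₂ _ _ onLink

  record Packing (xs : List ℕ) (Z : Pred Coord 0ℓ) : Set where
    field
      cycles   : List (List Coord)
      isCycles : Pointwise (λ x cs → IsCycle G (2 * x) (map φ cs)) xs cycles
      spread   : UniqueIn Z (concat cycles)
      valid    : All Valid (concat cycles)

  open Packing

  packing-[] : ∀ {Z} → Packing [] Z
  packing-[] = record { cycles = [] ; isCycles = [] ; spread = [] , [] ; valid = [] }

  packing-[_] : ∀ {x Z} cs → IsCycle G (2 * x) (map φ cs) → UniqueIn Z cs → All Valid cs → Packing [ x ] Z
  packing-[ cs ] cyc (ucs , Zcs) vcs = record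
    { cycles   = [ cs ]
    ; isCycles = cyc ∷ []
    ; spread   = subst (UniqueIn _) (sym (++-identityʳ cs)) (ucs , Zcs)
    ; valid    = subst (All Valid) (sym (++-identityʳ cs)) vcs
    }

  packing-++ : ∀ {xs ys P Q} → Packing xs P → Packing ys Q → P ⊥ Q → Packing (xs ++ ys) (P ∪ Q)
  packing-++ 𝒫 𝒬 P⊥Q = record
    { cycles   = cycles 𝒫 ++ cycles 𝒬
    ; isCycles = Pointwise.++⁺ (isCycles 𝒫) (isCycles 𝒬)
    ; spread   = subst (UniqueIn _) (concat-++ (cycles 𝒫) (cycles 𝒬)) (uniqueIn-++ (spread 𝒫) (spread 𝒬) P⊥Q)
    ; valid    = subst (All Valid) (concat-++ (cycles 𝒫) (cycles 𝒬)) (Allₚ.++⁺ (valid 𝒫) (valid 𝒬))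
    }

  packing-⊆ : ∀ {xs P Q} → P ⊆ Q → Packing xs P → Packing xs Q
  packing-⊆ P⊆Q 𝒫 = record
    { cycles = cycles 𝒫 ; isCycles = isCycles 𝒫 ; spread = uniqueIn-⊆ P⊆Q (spread 𝒫) ; valid = valid 𝒫 }

  packing⇒cycles : ∀ {xs Z} → Packing xs Z → HasDisjointEvenCycles G xs
  packing⇒cycles {xs} 𝒫 =
    map (map φ) (cycles 𝒫) ,
    subst (λ ys → Pointwise _ ys _) (map-id xs) (Pointwise.map⁺ id (map φ) (isCycles 𝒫)) ,
    subst Unique (sym (concat-map (cycles 𝒫))) (unique-map-on φ φ-injective (valid 𝒫) (proj₁ (spread 𝒫)))

  block-packing : ∀ ℓ o c → o + suc (suc c) ≤ rungs ℓ → Packing [ suc (suc c) ] (OnRungs ℓ o (o + suc (suc c)))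
  block-packing ℓ o c fits = packing-[ rungCycle ℓ upper lower o (suc c) ]
    (cycle-image _ (rungCycle-path ℓ upper lower o (suc c) (λ ()) (≤-trans (≤-reflexive end≡) fits))
      (rungCycle-length ℓ upper lower o (suc c)) (≤-trans (n≤1+n 3) (*-monoʳ-≤ 2 (s≤s (s≤s z≤n)))))
    (uniqueIn-⊆ (rungs-⊆ ≤-refl (≤-reflexive end≡)) (rungCycle-unique ℓ upper lower o (suc c) (λ ()) , onRungs))
    (All.map (λ v∈ → rungs-valid fits (rungs-⊆ ≤-refl (≤-reflexive end≡) v∈)) onRungs)
    where
    end≡ : suc (o + suc c) ≡ o + suc (suc c)
    end≡ = sym (+-suc o (suc c))
    onRungs : All (OnRungs ℓ o (suc (o + suc c))) (rungCycle ℓ upper lower o (suc c))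
    onRungs = rungCycle-onRungs ℓ upper lower o (suc c)

  ladder-packing : ∀ ℓ xs o → All (2 ≤_) xs → o + sum xs ≤ rungs ℓ → Packing xs (OnRungs ℓ o (o + sum xs))
  ladder-packing ℓ []                 o _                    _    = packing-[]
  ladder-packing ℓ (x@(suc (suc c)) ∷ xs) o (s≤s (s≤s z≤n) ∷ big) fits =
    packing-⊆ [ rungs-⊆ ≤-refl (+-monoʳ-≤ o (m≤m+n x (sum xs))) , rungs-⊆ (m≤m+n o x) (≤-reflexive (+-assoc o x (sum xs))) ]′
      (packing-++ (block-packing ℓ o c (≤-trans (+-monoʳ-≤ o (m≤m+n x (sum xs))) fits))
                  (ladder-packing ℓ xs (o + x) big (≤-trans (≤-reflexive (+-assoc o x (sum xs))) fits))
                  (rungs-⊥-below ≤-refl))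

  longCycle : ℕ → ℕ → List Coord
  longCycle c₁ c₂ = rungCycle first lower upper 0 c₁ ++ linkCoords upper ++ rungCycle second upper lower 0 c₂ ++ reversedLowerLink

  longCycle-path : ∀ c₁ c₂ → suc c₁ ≤ rungs first → suc c₂ ≤ rungs second →
             Path E (rail first lower , 0)
               ((zigzag first lower upper 0 c₁ ++ [ rail first upper , 0 ]) ++ linkCoords upper ++ rungCycle second upper lower 0 c₂ ++ reversedLowerLink)
               (rail first lower , 0)
  longCycle-path c₁ c₂ j₁≤ j₂≤ = subst (λ V → Path E _ V _) (sym regroup)
    (path-++ Z₁ (zigzag-path first lower upper 0 c₁ (λ ()) j₁≤)
      (path-++ (linkCoords upper) (link-path upper)
        (path-++ Z₂ (zigzag-path second upper lower 0 c₂ (λ ()) j₂≤) reversedLowerLink-path)))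
    where
    Z₁ Z₂ : List Coord
    Z₁ = zigzag first lower upper 0 c₁
    Z₂ = zigzag second upper lower 0 c₂
    regroup : (Z₁ ++ [ rail first upper , 0 ]) ++ linkCoords upper ++ rungCycle second upper lower 0 c₂ ++ reversedLowerLink ≡
              Z₁ ++ (rail first upper , 0) ∷ linkCoords upper ++ (rail second upper , 0) ∷ Z₂ ++ (rail second lower , 0) ∷ reversedLowerLink
    regroup = trans (++-assoc Z₁ _ _)
      (cong (λ V → Z₁ ++ (rail first upper , 0) ∷ linkCoords upper ++ (rail second upper , 0) ∷ V) (++-assoc Z₂ _ reversedLowerLink))

  longCycle-length : ∀ c₁ c₂ → length (longCycle c₁ c₂) ≡ 2 * (suc c₁ + suc c₂ + k)
  longCycle-length c₁ c₂ = begin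
    length (R₁ ++ linkCoords upper ++ R₂ ++ reversedLowerLink)
      ≡⟨ length-++ R₁ ⟩
    length R₁ + length (linkCoords upper ++ R₂ ++ reversedLowerLink)
      ≡⟨ cong (length R₁ +_) (length-++ (linkCoords upper)) ⟩
    length R₁ + (length (linkCoords upper) + length (R₂ ++ reversedLowerLink))
      ≡⟨ cong (λ n → length R₁ + (length (linkCoords upper) + n)) (length-++ R₂) ⟩
    length R₁ + (length (linkCoords upper) + (length R₂ + length reversedLowerLink))
      ≡⟨ cong₂ (λ a b → a + (length (linkCoords upper) + (b + length reversedLowerLink)))
           (rungCycle-length first lower upper 0 c₁) (rungCycle-length second upper lower 0 c₂) ⟩
    2 * suc c₁ + (length (linkCoords upper) + (2 * suc c₂ + length reversedLowerLink))
      ≡⟨ cong₂ (λ a b → 2 * suc c₁ + (a + (2 * suc c₂ + b))) (length-applyUpTo _ (length P1)) reversedLowerLink-length ⟩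
    2 * suc c₁ + (length P1 + (2 * suc c₂ + length P2))
      ≡⟨ e (suc c₁) (suc c₂) (length P1) (length P2) ⟩
    2 * (suc c₁ + suc c₂) + (length P1 + length P2)
      ≡⟨ cong (2 * (suc c₁ + suc c₂) +_) interiorSize ⟩
    2 * (suc c₁ + suc c₂) + 2 * k
      ≡⟨ *-distribˡ-+ 2 (suc c₁ + suc c₂) k ⟨
    2 * (suc c₁ + suc c₂ + k) ∎
    where
    open ≡-Reasoning
    R₁ R₂ : List Coord
    R₁ = rungCycle first lower upper 0 c₁
    R₂ = rungCycle second upper lower 0 c₂
    reversedLowerLink-length : length reversedLowerLink ≡ length P2
    reversedLowerLink-length = trans (cong length (sym (reverse-applyUpTo _ (length P2))))
      (trans (length-reverse (linkCoords lower)) (length-applyUpTo _ (length P2)))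
    e : ∀ a b l₁ l₂ → 2 * a + (l₁ + (2 * b + l₂)) ≡ 2 * (a + b) + (l₁ + l₂)
    e = solve-∀

  longCycle-packing : ∀ c₁ c₂ → suc c₁ ≤ rungs first → suc c₂ ≤ rungs second →
                Packing [ suc c₁ + suc c₂ + k ] (OnLongCycle (suc c₁) (suc c₂))
  longCycle-packing c₁ c₂ j₁≤ j₂≤ = packing-[ longCycle c₁ c₂ ]
    (cycle-image _ (longCycle-path c₁ c₂ j₁≤ j₂≤) (longCycle-length c₁ c₂)
      (≤-trans (n≤1+n 3) (*-monoʳ-≤ 2 (s≤s (≤-trans (s≤s z≤n) (≤-trans (m≤n+m (suc c₂) c₁) (m≤m+n _ k)))))))
    (uniqueIn-++ (rungCycle-unique first lower upper 0 c₁ (λ ()) , rungCycle-onRungs first lower upper 0 c₁)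
      (uniqueIn-++ (link-uniqueIn upper)
        (uniqueIn-++ (rungCycle-unique second upper lower 0 c₂ (λ ()) , rungCycle-onRungs second upper lower 0 c₂)
          reversedLowerLink-uniqueIn rungs-⊥-link)
        link⊥rest)
      rungs⊥rest)
    (Allₚ.++⁺ (All.map (rungs-valid j₁≤) (rungCycle-onRungs first lower upper 0 c₁))
      (Allₚ.++⁺ (link-valid upper)
        (Allₚ.++⁺ (All.map (rungs-valid j₂≤) (rungCycle-onRungs second upper lower 0 c₂)) reversedLowerLink-valid)))
    where
    link⊥rest : OnLink upper ⊥ (OnRungs second 0 (suc c₂) ∪ OnLink lower)
    link⊥rest (onLink _ , inj₁ ())
    link⊥rest (onLink _ , inj₂ ())
    rungs⊥rest : OnRungs first 0 (suc c₁) ⊥ (OnLink upper ∪ OnRungs second 0 (suc c₂) ∪ OnLink lower)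
    rungs⊥rest (onRung _ _ _ , inj₁ ())
    rungs⊥rest (onRung _ _ _ , inj₂ (inj₁ ()))
    rungs⊥rest (onRung _ _ _ , inj₂ (inj₂ ()))

  layout⇒cycles : ∀ {ns} → All (2 ≤_) ns → Layout (suc m1) (suc m2) k n'' ns → HasDisjointEvenCycles G ns
  layout⇒cycles big (inLadders Y₁ Y₂ Y₃ refl fits₁ fits₂ fits₃) = packing⇒cycles
    (packing-++ (ladder-packing spare Y₁ 0 (Allₚ.++⁻ˡ Y₁ big) fits₁)
      (packing-++ (ladder-packing first Y₂ 0 (Allₚ.++⁻ˡ Y₂ big₂₃) fits₂)
                  (ladder-packing second Y₃ 0 (Allₚ.++⁻ʳ Y₂ big₂₃) fits₃)
                  (rungs-⊥-ladders λ ()))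
      S⊥FT)
    where
    big₂₃ : All (2 ≤_) (Y₂ ++ Y₃)
    big₂₃ = Allₚ.++⁻ʳ Y₁ big
    S⊥FT : OnRungs spare 0 (sum Y₁) ⊥ (OnRungs first 0 (sum Y₂) ∪ OnRungs second 0 (sum Y₃))
    S⊥FT (s , inj₁ f) = rungs-⊥-ladders (λ ()) (s , f)
    S⊥FT (s , inj₂ t) = rungs-⊥-ladders (λ ()) (s , t)
  layout⇒cycles big (withLongCycle Y₁ Y₂ Y₃ j₁@(suc c₁) j₂@(suc c₂) refl fits₁ fits₂ fits₃ (s≤s z≤n) (s≤s z≤n)) = packing⇒cycles
    (packing-++ (ladder-packing spare Y₁ 0 (Allₚ.++⁻ˡ Y₁ big) fits₁)
      (packing-++ (ladder-packing first Y₂ j₁ (Allₚ.++⁻ˡ Y₂ big₂₃₄) fits₂)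
        (packing-++ (ladder-packing second Y₃ j₂ (Allₚ.++⁻ˡ Y₃ (Allₚ.++⁻ʳ Y₂ big₂₃₄)) fits₃)
          (longCycle-packing c₁ c₂ (≤-trans (m≤m+n j₁ _) fits₂) (≤-trans (m≤m+n j₂ _) fits₃))
          T⊥C)
        F⊥TC)
      S⊥FTC)
    where
    big₂₃₄ : All (2 ≤_) (Y₂ ++ Y₃ ++ [ j₁ + j₂ + k ])
    big₂₃₄ = Allₚ.++⁻ʳ Y₁ big
    S F T : Pred Coord 0ℓ
    S = OnRungs spare 0 (sum Y₁)
    F = OnRungs first j₁ (j₁ + sum Y₂)
    T = OnRungs second j₂ (j₂ + sum Y₃)
    T⊥C : T ⊥ OnLongCycle j₁ j₂
    T⊥C = rungs-⊥-longCycle (λ ()) (λ _ → ≤-refl)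
    F⊥TC : F ⊥ (T ∪ OnLongCycle j₁ j₂)
    F⊥TC (f , inj₁ t) = rungs-⊥-ladders (λ ()) (f , t)
    F⊥TC (f , inj₂ h) = rungs-⊥-longCycle (λ _ → ≤-refl) (λ ()) (f , h)
    S⊥FTC : S ⊥ (F ∪ T ∪ OnLongCycle j₁ j₂)
    S⊥FTC (s , inj₁ f)        = rungs-⊥-ladders (λ ()) (s , f)
    S⊥FTC (s , inj₂ (inj₁ t)) = rungs-⊥-ladders (λ ()) (s , t)
    S⊥FTC (s , inj₂ (inj₂ h)) = rungs-⊥-longCycle (λ ()) (λ ()) (s , h)

-- The exceptional case

near-pair-bounds : ∀ {r x c} → 1 ≤ r → x ≤ c → c ≤ x + r →
  ⌊ (x + c + 1 ∸ r) /2⌋ ≤ x × 2 * x ≤ x + c × x + c ≤ 2 * c × c ≤ ⌈ (x + c + r ∸ 1) /2⌉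
near-pair-bounds {r} {x} {c} 1≤r x≤c c≤x+r = half-below , +-monoʳ-≤ x (subst (_≤ c) (sym (+-identityʳ x)) x≤c)
  , +-mono-≤ x≤c (≤-reflexive (sym (+-identityʳ c))) , half-above
  where
  half-below : ⌊ (x + c + 1 ∸ r) /2⌋ ≤ x
  half-below = ≤-trans (⌊n/2⌋-mono (begin
    x + c + 1 ∸ r          ≤⟨ ∸-monoˡ-≤ r (+-monoˡ-≤ 1 (+-monoʳ-≤ x c≤x+r)) ⟩
    x + (x + r) + 1 ∸ r    ≡⟨ cong (_∸ r) (e x r) ⟩
    suc (x + x) + r ∸ r    ≡⟨ m+n∸n≡m (suc (x + x)) r ⟩
    suc (x + x)            ∎)) (≤-reflexive (sym (n≡⌈n+n/2⌉ x)))
    where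
    open ≤-Reasoning
    e : ∀ x r → x + (x + r) + 1 ≡ suc (x + x) + r
    e = solve-∀
  half-above : c ≤ ⌈ (x + c + r ∸ 1) /2⌉
  half-above = ≤-trans (≤-reflexive (n≡⌊n+n/2⌋ c)) (⌊n/2⌋-mono (begin
    c + c                  ≤⟨ +-monoʳ-≤ c c≤x+r ⟩
    c + (x + r)            ≡⟨ e x c r ⟩
    x + c + r              ≡⟨ m∸n+n≡m (≤-trans 1≤r (m≤n+m r (x + c))) ⟨
    x + c + r ∸ 1 + 1      ≡⟨ +-comm _ 1 ⟩
    suc (x + c + r ∸ 1)    ∎))
    where
    open ≤-Reasoning
    e : ∀ x c r → c + (x + r) ≡ x + c + r
    e = solve-∀

one-or-two : ∀ {r} → r ≡ 1 ⊎ r ≡ 2 → 1 ≤ r × r ≤ 2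
one-or-two (inj₁ refl) = s≤s z≤n , s≤s z≤n
one-or-two (inj₂ refl) = s≤s z≤n , s≤s (s≤s z≤n)

spare-capacity : ∀ {k n M} → 6 * k + 12 ≤ n → n ≤ 3 * M → 2 * k + 4 ≤ M
spare-capacity {k} 6k+12≤n n≤3M = *-cancelˡ-≤ 3 (≤-trans (≤-reflexive (e k)) (≤-trans 6k+12≤n n≤3M))
  where
  e : ∀ k → 3 * (2 * k + 4) ≡ 6 * k + 12
  e = solve-∀

m∸n≤o⇒m≤o+n : ∀ {m n o} → m ∸ n ≤ o → m ≤ o + n
m∸n≤o⇒m≤o+n {m} {n} {o} m∸n≤o = ≤-trans (m≤n+m∸n m n) (≤-trans (+-monoʳ-≤ n m∸n≤o) (≤-reflexive (+-comm n o)))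

corollary3p4 : ∀ {N : ℕ} (G : Graph N) (r : ℕ) (ns : List ℕ) (n' k n'' : ℕ)
    → (r ≡ 1 ⊎ r ≡ 2)
    → All (2 ≤_) ns
    → Linked _≤_ ns
    → (W : WeakLadder G n' k)
    → sum ns ∸ r ≤ n'
    → r ≤ k
    → 6 * k + 12 ≤ sum ns
    → (L : Ladder G n'')
    → Unique (weakLadderVerts G W ++ ladderVerts G L)
    → sum ns ≤ 3 * n''
    → ¬ HasDisjointEvenCycles G ns
    → ∃[ n₁ ] ∃[ n₂ ] (ns ≡ n₁ ∷ n₂ ∷ []
        × ⌊ (sum ns + 1 ∸ r) /2⌋ ≤ n₁
        × 2 * n₁ ≤ sum ns
        × sum ns ≤ 2 * n₂
        × n₂ ≤ ⌈ (sum ns + r ∸ 1) /2⌉)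
corollary3p4 G r ns n' k n'' r∈1,2 big sorted W n∸r≤n' r≤k 6k+12≤n L distinct n≤3n'' noCycles
  with one-or-two r∈1,2 | nearPair? r ns
... | 1≤r , _ | yes (x , c , refl , c≤x+r) rewrite +-identityʳ c =
  x , c , refl , near-pair-bounds 1≤r (x≤c sorted) c≤x+r
  where
  x≤c : Linked _≤_ (x ∷ c ∷ []) → x ≤ c
  x≤c (x≤c ∷ _) = x≤c
... | 1≤r , r≤2 | no far = ⊥-elim (noCycles (Embedding.layout⇒cycles G W L distinct big
  (layout 1≤r r≤2 r≤k (s≤s z≤n) n1≤n2 (spare-capacity {k} 6k+12≤n n≤3n'') ns big (Linkedₚ.Linked⇒AllPairs ≤-trans sorted)
     (m∸n≤o⇒m≤o+n (subst (sum ns ∸ r ≤_) (sym total) n∸r≤n')) n≤3n'' far)))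
  where open WeakLadder W using (n1≤n2; total)
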